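{- Let $R$ be a tolerance on $U$ induced by a covering $\mathcal{H}$ of $U$, let $B\in\mathcal{H}$ and $X\subseteq U$. Then: (a) $X^{\uparrow}=\bigcup\{C\in\mathcal{H}\mid X\cap C\ne\emptyset\}$; (b) $B^{\downarrow}=\{x\in U\mid R(x)=B\}$; (c) if $\mathcal{H}$ is irredundant, then $\emptyset\ne B^{\downarrow}=B\setminus\bigcup(\mathcal{H}\setminus\{B\})$.
   Context: A tolerance on $U$ is a reflexive symmetric relation; $R(x)=\{y\mid x\,R\,y\}$; $X^{\downarrow}=\{x\in U\mid R(x)\subseteq X\}$ and $X^{\uparrow}=\{x\in U\mid R(x)\cap X\ne\emptyset\}$. A covering of $U$ is a family $\mathcal{H}$ of nonempty subsets of $U$ with union $U$; it is irredundant if no $\mathcal{H}\setminus\{X\}$ ($X\in\mathcal{H}$) is a covering. The tolerance induced by $\mathcal{H}$ is $\bigcup\{X\times X\mid X\in\mathcal{H}\}$. -}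

module Defs where

open import Level using (Level)
open import Data.Product using (Σ; Σ-syntax; _×_; _,_; proj₁)
open import Relation.Nullary using (¬_)
open import Relation.Unary using (Pred; _⊆_; _≐_; _∩_; ∅; ⋃)

-- Sets over a carrier U are predicates `Pred U ℓ`; equality of subsets is
-- extensional equality `_≐_`.  "Y ≠ ∅" is rendered literally as ¬ (Y ≐ ∅).
-- A family of subsets ℋ is given as an indexed family `H : I → Pred U ℓ`
-- (the set ℋ is its image).

module _ {ℓ : Level} {U : Set ℓ} where

  IsCovering : {J : Set ℓ} → (J → Pred U ℓ) → Set ℓ
  IsCovering {J} F = ((j : J) → ¬ (F j ≐ ∅)) × ((x : U) → ⋃ J F x)

  module _ {I : Set ℓ} (H : I → Pred U ℓ) where

    -- index set of ℋ ∖ {X}: members of ℋ different (as sets) from X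
    IdxWithout : Pred U ℓ → Set ℓ
    IdxWithout X = Σ[ i ∈ I ] ¬ (H i ≐ X)

    Without : (X : Pred U ℓ) → IdxWithout X → Pred U ℓ
    Without X j = H (proj₁ j)

    Irredundant : Set ℓ
    Irredundant = (i : I) → ¬ IsCovering (Without (H i))

    Induced : U → U → Set ℓ
    Induced x y = Σ[ i ∈ I ] (H i x × H i y)

  module _ (R : U → U → Set ℓ) where

    nbhd : U → Pred U ℓ
    nbhd x = R x

    lower : Pred U ℓ → Pred U ℓ
    lower X x = nbhd x ⊆ X

    upper : Pred U ℓ → Pred U ℓ
    upper X x = ¬ ((nbhd x ∩ X) ≐ ∅)

-- R(x) is the union of the blocks containing x.  So R(x) ⊆ B means every block
-- through x lies inside B, which (as B itself contains x) is R(x) = B; and a point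
-- in no block other than B has R(x) ⊆ B.  Under irredundancy a block C ⊆ B with
-- C ≠ B could be dropped, B still covering C, so the points of B↓ lie in no other
-- block; and if B↓ were empty, ℋ ∖ {B} would already cover U.
module Submission where

open import Defs
open import Level using (Level)
open import Data.Product using (Σ; Σ-syntax; _×_; _,_; proj₁; proj₂)
open import Function using (_∘_)
open import Relation.Nullary using (¬_; yes; no)
open import Relation.Unary using (Pred; _⊆_; _≐_; _∩_; _∖_; ∅; ⋃; ∁; Satisfiable)
open import Relation.Unary.Properties using (≐-sym)
open import Axiom.ExcludedMiddle using (ExcludedMiddle)
open import Axiom.DoubleNegationElimination using (em⇒dne)

module _ {ℓ : Level} {A : Set ℓ} {P : Pred A ℓ} where

  satisfiable⇒≉∅ : Satisfiable P → ¬ (P ≐ ∅)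
  satisfiable⇒≉∅ (_ , Px) (P⊆∅ , _) = P⊆∅ Px

  ≉∅⇒satisfiable : ExcludedMiddle ℓ → ¬ (P ≐ ∅) → Satisfiable P
  ≉∅⇒satisfiable lem P≉∅ = em⇒dne lem λ ¬sat → P≉∅ ((λ Px → ¬sat (_ , Px)) , λ ())

module _ {ℓ : Level} {U I : Set ℓ} (H : I → Pred U ℓ) where

  Others : I → Pred U ℓ
  Others b = ⋃ (IdxWithout H (H b)) (Without H (H b))

  induced-refl : ((x : U) → ⋃ I H x) → (x : U) → Induced H x x
  induced-refl covers x = let (i , Hix) = covers x in i , Hix , Hix

  upper-induced : ExcludedMiddle ℓ → (X : Pred U ℓ) →
    upper (Induced H) X ≐ ⋃ (Σ[ i ∈ I ] ¬ ((X ∩ H i) ≐ ∅)) (λ c → H (proj₁ c))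
  upper-induced lem X = to , from
    where
    to : upper (Induced H) X ⊆ ⋃ (Σ[ i ∈ I ] ¬ ((X ∩ H i) ≐ ∅)) (λ c → H (proj₁ c))
    to R[x]∩X≉∅ with ≉∅⇒satisfiable lem R[x]∩X≉∅
    ... | y , (i , Hix , Hiy) , Xy = (i , satisfiable⇒≉∅ (y , Xy , Hiy)) , Hix

    from : ⋃ (Σ[ i ∈ I ] ¬ ((X ∩ H i) ≐ ∅)) (λ c → H (proj₁ c)) ⊆ upper (Induced H) X
    from ((i , X∩Hi≉∅) , Hix) with ≉∅⇒satisfiable lem X∩Hi≉∅
    ... | y , Xy , Hiy = satisfiable⇒≉∅ (y , (i , Hix , Hiy) , Xy)

  lower-induced-block : ((x : U) → ⋃ I H x) → (b : I) →
    lower (Induced H) (H b) ≐ (λ x → nbhd (Induced H) x ≐ H b)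
  lower-induced-block covers b = to , proj₁
    where
    to : lower (Induced H) (H b) ⊆ (λ x → nbhd (Induced H) x ≐ H b)
    to {x} R[x]⊆Hb = R[x]⊆Hb , λ Hby → b , R[x]⊆Hb (induced-refl covers x) , Hby

  ∉Others⇒lower : ExcludedMiddle ℓ → (b : I) → ∁ (Others b) ⊆ lower (Induced H) (H b)
  ∉Others⇒lower lem b x∉Others (i , Hix , Hiy) =
    proj₁ (em⇒dne lem λ Hi≉Hb → x∉Others ((i , Hi≉Hb) , Hix)) Hiy

  covering-without-subsumed : ExcludedMiddle ℓ → IsCovering H → {j b : I} →
    H j ⊆ H b → ¬ (H b ≐ H j) → IsCovering (Without H (H j))
  covering-without-subsumed lem (nonempty , covers) {j} {b} Hj⊆Hb Hb≉Hj =
    nonempty ∘ proj₁ , cover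
    where
    cover : (z : U) → ⋃ (IdxWithout H (H j)) (Without H (H j)) z
    cover z with covers z
    ... | i , Hiz with lem {H i ≐ H j}
    ...   | no Hi≉Hj = (i , Hi≉Hj) , Hiz
    ...   | yes Hi≐Hj = (b , Hb≉Hj) , Hj⊆Hb (proj₁ Hi≐Hj Hiz)

  irredundant⇒subsumed-≐ : ExcludedMiddle ℓ → IsCovering H → Irredundant H →
    {j b : I} → H j ⊆ H b → H j ≐ H b
  irredundant⇒subsumed-≐ lem cov irr {j} Hj⊆Hb = em⇒dne lem λ Hj≉Hb →
    irr j (covering-without-subsumed lem cov Hj⊆Hb (Hj≉Hb ∘ ≐-sym))

  irredundant⇒lower⊆block∖Others : ExcludedMiddle ℓ → IsCovering H → Irredundant H →
    (b : I) → lower (Induced H) (H b) ⊆ (H b ∖ Others b)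
  irredundant⇒lower⊆block∖Others lem cov irr b {x} R[x]⊆Hb =
    R[x]⊆Hb (induced-refl (proj₂ cov) x) ,
    λ ((j , Hj≉Hb) , Hjx) →
      Hj≉Hb (irredundant⇒subsumed-≐ lem cov irr λ Hjy → R[x]⊆Hb (j , Hjx , Hjy))

  irredundant⇒lower≉∅ : ExcludedMiddle ℓ → IsCovering H → Irredundant H →
    (b : I) → ¬ (lower (Induced H) (H b) ≐ ∅)
  irredundant⇒lower≉∅ lem (nonempty , _) irr b (lower⊆∅ , _) =
    irr b (nonempty ∘ proj₁ , λ _ → em⇒dne lem (lower⊆∅ ∘ ∉Others⇒lower lem b))

lemma3p2 : {ℓ : Level} → ExcludedMiddle ℓ →
    {U : Set ℓ} {I : Set ℓ} (H : I → Pred U ℓ) → IsCovering H →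
    (b : I) (X : Pred U ℓ) →
    (upper (Induced H) X ≐ ⋃ (Σ[ i ∈ I ] ¬ ((X ∩ H i) ≐ ∅)) (λ c → H (Σ.proj₁ c)))
    × (lower (Induced H) (H b) ≐ (λ x → nbhd (Induced H) x ≐ H b))
    × (Irredundant H →
        ¬ (lower (Induced H) (H b) ≐ ∅)
        × (lower (Induced H) (H b) ≐ (H b ∖ ⋃ (IdxWithout H (H b)) (Without H (H b)))))
lemma3p2 lem H cov b X =
  upper-induced H lem X ,
  lower-induced-block H (proj₂ cov) b ,
  λ irr →
    irredundant⇒lower≉∅ H lem cov irr b ,
    irredundant⇒lower⊆block∖Others H lem cov irr b ,
    ∉Others⇒lower H lem b ∘ proj₂
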